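{- Let $Q$ be a query graph and $D$ a data graph, let $T$ be a breadth-first-search tree of $Q$, and let the enumeration order $o$ be a BFS order of $Q$ along $T$, so that every non-root query vertex $u$ is preceded in $o$ by its parent $u.p$ in $T$. Let $u$ be a non-root query vertex and let $s\in C(u)$ be an invalid candidate for $u$ which has been removed from $C(u)$ and from $I_{u}^{u.p}(t)$ for every $t\in C(u.p)$, while the index entries $I_{u.f}^{u}(s)$ for all forward neighbours $u.f\in N_{+}^{o}(u)$ are retained. Then in the enumeration step $s$ is never mapped to $u$ (i.e. $\mu[u]\neq s$ for every partial mapping $\mu$ produced), so retaining $I_{u.f}^{u}(s)$ for all $u.f\in N_{+}^{o}(u)$ never yields $s$ as a false positive candidate mapped to $u$.
   Context: Graphs are undirected and vertex-labelled by a label function $L$. For a vertex $x$, $N(x)$ is its neighbour set and $|x|$ its degree. For a query vertex $u$, the candidate set $C(u)\subseteq V(D)$ consists of data vertices $s$ with $L(s)=L(u)$ and $|s|\ge |u|$ (possibly further filtered). For a query edge $e_Q(u,v)\in E(Q)$ and $s\in C(u)$, the auxiliary index entry is $I_{v}^{u}(s)=N(s)\cap C(v)$. For an enumeration order $o$ (a sequence of all query vertices), $N_{ - }^{o}(u)$ (resp. $N_{+}^{o}(u)$) is the set of neighbours of $u$ in $Q$ appearing before (resp. after) $u$ in $o$. The enumeration step is a backtracking search following $o$ that maintains a partial mapping $\mu$ from already processed query vertices to data vertices; for a non-root query vertex $w$ the local candidate set is $LC(w)=\bigcap_{w.b\in N_{ - }^{o}(w)} I_{w}^{w.b}(\mu[w.b])$,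 and $\mu[w]$ is always chosen from $LC(w)$ (so the entries $I_{u.f}^{u}(\cdot)$ are only consulted at the value $\mu[u]$). A candidate $s\in C(u)$ is invalid if it cannot be the image of $u$ in any embedding (injective label- and edge-preserving map $V(Q)\to V(D)$). -}

module Defs where

open import Data.Nat using (ℕ; zero; suc; _≤_; _+_)
open import Data.Fin as Fin using (Fin; toℕ)
open import Data.Bool using (Bool; true; false; if_then_else_)
open import Data.List using (List; map)
open import Data.Nat.ListAction using (sum)
open import Data.List.Base using (allFin)
open import Data.Maybe using (Maybe; just; nothing)
open import Data.Product using (_×_; Σ; ∃; _,_)
open import Relation.Nullary using (¬_; does)
open import Relation.Binary.PropositionalEquality using (_≡_; _≢_)
open import Function.Definitions using (Injective)

record Graph : Set where
  field
    size    : ℕ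
    adj     : Fin size → Fin size → Bool
    adj-sym : ∀ a b → adj a b ≡ adj b a
    adj-irr : ∀ a → adj a a ≡ false
    label   : Fin size → ℕ

open Graph public

Edge : (G : Graph) → Fin (size G) → Fin (size G) → Set
Edge G a b = adj G a b ≡ true

deg : (G : Graph) → Fin (size G) → ℕ
deg G x = sum (map (λ y → if adj G x y then 1 else 0) (allFin (size G)))

IsEmbedding : (Q D : Graph) → (Fin (size Q) → Fin (size D)) → Set
IsEmbedding Q D f =
  Injective _≡_ _≡_ f
  × (∀ v → label D (f v) ≡ label Q v)
  × (∀ a b → Edge Q a b → Edge D (f a) (f b))

Invalid : (Q D : Graph) → Fin (size Q) → Fin (size D) → Set
Invalid Q D u s = ¬ (Σ (Fin (size Q) → Fin (size D)) λ f → IsEmbedding Q D f × f u ≡ s)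

record Setting : Set₁ where
  field
    Q D : Graph

    -- candidate sets C(w) ⊆ V(D) (possibly further filtered)
    C      : Fin (size Q) → Fin (size D) → Set
    C-lab  : ∀ w x → C w x → label D x ≡ label Q w
    C-deg  : ∀ w x → C w x → deg Q w ≤ deg D x

    root      : Fin (size Q)
    par       : Fin (size Q) → Fin (size Q)   -- value at root is irrelevant
    depth     : Fin (size Q) → ℕ
    depth-root : depth root ≡ 0
    par-edge  : ∀ w → w ≢ root → Edge Q w (par w)
    par-depth : ∀ w → w ≢ root → depth w ≡ suc (depth (par w))
    -- breadth-first: every query edge joins vertices in the same or adjacent layers
    -- (together with the above, depth = BFS distance from root)
    bfs-edge  : ∀ a b → Edge Q a b → depth a ≤ suc (depth b)

    -- enumeration order o (position ↦ vertex), a bijection with inverse pos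
    o       : Fin (size Q) → Fin (size Q)
    pos     : Fin (size Q) → Fin (size Q)
    pos-o   : ∀ i → pos (o i) ≡ i
    o-pos   : ∀ v → o (pos v) ≡ v
    o-depth : ∀ i j → toℕ i ≤ toℕ j → depth (o i) ≤ depth (o j)
    o-par   : ∀ a b → a ≢ root → b ≢ root →
              Fin._<_ (pos (par a)) (pos (par b)) → Fin._<_ (pos a) (pos b)

    u        : Fin (size Q)
    u-nonroot : u ≢ root
    s        : Fin (size D)
    s∈C      : C u s
    s-invalid : Invalid Q D u s

  -- original auxiliary index: I_v^w(t) = N(t) ∩ C(v), for the query edge (w,v)
  I : (v w : Fin (size Q)) → Fin (size D) → Fin (size D) → Set
  I v w t x = Edge D t x × C v x

  C′ : Fin (size Q) → Fin (size D) → Set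
  C′ w x = C w x × (w ≡ u → x ≢ s)

  I′ : (v w : Fin (size Q)) → Fin (size D) → Fin (size D) → Set
  I′ v w t x = I v w t x × ((v ≡ u × w ≡ par u × C (par u) t) → x ≢ s)

  PMap : Set
  PMap = Fin (size Q) → Maybe (Fin (size D))

  _[_↦_] : PMap → Fin (size Q) → Fin (size D) → PMap
  (μ [ w ↦ x ]) v = if does (v Fin.≟ w) then just x else μ v

  -- x ∈ LC(w) w.r.t. μ, where the already-mapped vertices are exactly
  -- those placed before w in o.  For the first vertex (root) LC = C′.
  InLC : ℕ → PMap → Fin (size Q) → Fin (size D) → Set
  InLC zero    μ w x = C′ w x
  InLC (suc _) μ w x = ∀ b t → Edge Q w b → μ b ≡ just t → I′ w b t x

  -- Produced k μ : μ is a partial mapping produced by the backtracking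
  -- enumeration after processing the first k vertices of o.
  data Produced : ℕ → PMap → Set where
    start  : Produced zero (λ _ → nothing)
    extend : ∀ {k μ} → Produced k μ → (i : Fin (size Q)) → toℕ i ≡ k →
             (x : Fin (size D)) → InLC k μ (o i) x →
             Produced (suc k) (μ [ o i ↦ x ])

{-# OPTIONS --safe #-}
module Submission where

open import Defs
open import Data.Nat using (ℕ; zero; suc; z≤n; s≤s; s≤s⁻¹; _≤_; _<_)
open import Data.Nat.Properties
  using (≤-trans; n≤0⇒n≡0; 1+n≰n; ≰⇒>; 0≢1+n; m≤n⇒m<n∨m≡n)
open import Data.Fin as Fin using (Fin; toℕ; fromℕ<)
open import Data.Fin.Properties using (toℕ<n; toℕ-fromℕ<; toℕ-injective)
open import Data.Product using (∃; _,_; proj₁; proj₂)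
open import Data.Sum using (inj₁; inj₂)
open import Relation.Nullary using (yes; no; contradiction)
open import Data.Maybe using (just)
open import Relation.Binary.PropositionalEquality
  using (_≡_; _≢_; refl; sym; trans; cong; subst)

-- A value x can only be chosen for a non-root vertex w through LC(w),
-- which is contained in the index entry I′_w^{w.p}(μ[w.p]).  In a BFS order the
-- root comes first and every parent precedes its children, so w.p is already
-- mapped, and by induction to a genuine candidate of C(w.p); at such arguments s
-- has been removed from I′_u^{u.p}.  Hence every produced mapping sends each
-- vertex into the filtered candidate set C′, and s ∉ C′(u).  The retained entries
-- I_{u.f}^u(s) would only be consulted at μ[u] = s, which therefore never arises.

module _ (S : Setting) where
  open Setting S

  o-injective : ∀ {i j} → o i ≡ o j → i ≡ j
  o-injective {i} {j} oi≡oj = trans (sym (pos-o i)) (trans (cong pos oi≡oj) (pos-o j))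

  depth≡0⇒root : ∀ w → depth w ≡ 0 → w ≡ root
  depth≡0⇒root w dw≡0 with w Fin.≟ root
  ... | yes w≡root = w≡root
  ... | no  w≢root = contradiction (trans (sym dw≡0) (par-depth w w≢root)) 0≢1+n

  pos-mono-depth : ∀ {v w} → toℕ (pos v) ≤ toℕ (pos w) → depth v ≤ depth w
  pos-mono-depth {v} {w} pv≤pw =
    subst (depth v ≤_) (cong depth (o-pos w))
      (subst (_≤ depth (o (pos w))) (cong depth (o-pos v)) (o-depth _ _ pv≤pw))

  -- The vertex at position 0 has depth at most that of the root, hence is the root.
  root-first : ∀ i → o i ≡ root → toℕ i ≡ 0
  root-first i oi≡root = trans (cong toℕ (sym z≡i)) (toℕ-fromℕ< _)
    where
    z : Fin (size Q)
    z = fromℕ< (≤-trans (s≤s z≤n) (toℕ<n i))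

    oz≡root : o z ≡ root
    oz≡root = depth≡0⇒root (o z) (n≤0⇒n≡0
      (subst (depth (o z) ≤_) (trans (cong depth oi≡root) depth-root)
        (o-depth z i (subst (_≤ toℕ i) (sym (toℕ-fromℕ< _)) z≤n))))

    z≡i : z ≡ i
    z≡i = o-injective (trans oz≡root (sym oi≡root))

  par-before : ∀ w → w ≢ root → toℕ (pos (par w)) < toℕ (pos w)
  par-before w w≢root = ≰⇒> λ pw≤ppw →
    1+n≰n (subst (_≤ depth (par w)) (par-depth w w≢root) (pos-mono-depth pw≤ppw))

  Sound : PMap → Set
  Sound μ = ∀ w t → μ w ≡ just t → C′ w t

  Covers : ℕ → PMap → Set
  Covers k μ = ∀ w → toℕ (pos w) < k → ∃ λ t → μ w ≡ just t

  sound-↦ : ∀ {μ w x} → Sound μ → C′ w x → Sound (μ [ w ↦ x ])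
  sound-↦ {w = w} sμ c′ v t μv≡t with v Fin.≟ w
  sound-↦ sμ c′ v t refl | yes refl = c′
  ... | no _ = sμ v t μv≡t

  covers-↦ : ∀ {k μ i x} → Covers k μ → toℕ i ≡ k → Covers (suc k) (μ [ o i ↦ x ])
  covers-↦ {i = i} {x} cov i≡k v v<1+k with v Fin.≟ o i
  ... | yes _ = x , refl
  ... | no v≢oi with m≤n⇒m<n∨m≡n (s≤s⁻¹ v<1+k)
  ...   | inj₁ v<k = cov v v<k
  ...   | inj₂ v≡k =
          contradiction (trans (sym (o-pos v)) (cong o (toℕ-injective (trans v≡k (sym i≡k))))) v≢oi

  LC⊆C′ : ∀ {k μ i x} → Sound μ → Covers k μ → toℕ i ≡ k → InLC k μ (o i) x → C′ (o i) x
  LC⊆C′ {zero} _ _ _ lc = lc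
  LC⊆C′ {suc k} {μ} {i} {x} sμ cov i≡1+k lc = via-parent (cov (par (o i)) parent-placed)
    where
    oi≢root : o i ≢ root
    oi≢root oi≡root = 0≢1+n (trans (sym (root-first i oi≡root)) i≡1+k)

    parent-placed : toℕ (pos (par (o i))) < suc k
    parent-placed = subst (toℕ (pos (par (o i))) <_) (trans (cong toℕ (pos-o i)) i≡1+k)
                      (par-before (o i) oi≢root)

    via-parent : (∃ λ t → μ (par (o i)) ≡ just t) → C′ (o i) x
    via-parent (t , μp≡t) = proj₂ (proj₁ entry) , λ oi≡u →
      proj₂ entry (oi≡u , cong par oi≡u , subst (λ w → C (par w) t) oi≡u (proj₁ (sμ _ t μp≡t)))
      where
      entry : I′ (o i) (par (o i)) t x
      entry = lc (par (o i)) t (par-edge (o i) oi≢root) μp≡t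

  produced-covers : ∀ {k μ} → Produced k μ → Covers k μ
  produced-covers start          w ()
  produced-covers (extend P i i≡k x _) = covers-↦ (produced-covers P) i≡k

  produced-sound : ∀ {k μ} → Produced k μ → Sound μ
  produced-sound start                 w t ()
  produced-sound (extend P i i≡k x lc) =
    sound-↦ (produced-sound P) (LC⊆C′ (produced-sound P) (produced-covers P) i≡k lc)

lemma2 : (S : Setting) → let open Setting S in
         ∀ (k : ℕ) (μ : PMap) → Produced k μ → μ u ≢ just s
lemma2 S k μ P μu≡s = proj₂ (produced-sound S P _ _ μu≡s) refl refl
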